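{- Let $G$ be a graph with bandwidth $b$, and let $H$ be a two-terminal edge gadget on $t$ vertices. Let $G_H$ be obtained from $G$ by replacing every edge of $G$ by $H$. Then $\mathrm{bw}(G_H)\le (b+1)\bigl(1+(t-2)b\bigr)$.
   Context: The bandwidth $\mathrm{bw}(G)$ of a graph $G$ on $n$ vertices is the minimum over bijections $\sigma:V(G)\to[n]$ of $\max_{uv\in E(G)}|\sigma(u)-\sigma(v)|$. A two-terminal edge gadget is a graph $H$ with two distinguished distinct attachment vertices $\alpha,\beta$. Replacing an edge $uv$ of a graph by $H$ means taking a fresh copy $H_{uv}$ of $H$ and identifying its two attachment vertices with $u$ and $v$ (in either order); the edge $uv$ itself is present afterwards only if it is an edge of $H_{uv}$. -}

module Defs where

open import Data.Nat using (ℕ; _≤_; _<ᵇ_; ∣_-_∣)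
open import Data.Fin using (Fin; toℕ; _≟_)
open import Data.Bool using (Bool; true; false; T; _∧_)
open import Data.Product using (Σ; Σ-syntax; _×_; _,_; proj₁; proj₂)
open import Data.Sum using (_⊎_; inj₁; inj₂)
open import Function.Bundles using (_⤖_; Bijection)
open import Relation.Binary.PropositionalEquality using (_≡_; _≢_)
open import Relation.Nullary.Decidable using (yes; no; False; fromWitnessFalse)

record Graph (n : ℕ) : Set where
  field
    adj    : Fin n → Fin n → Bool
    sym    : ∀ i j → adj i j ≡ adj j i
    irrefl : ∀ i → adj i i ≡ false
open Graph public

record Gadget (t : ℕ) : Set where
  field
    graph : Graph t
    α     : Fin t
    β     : Fin t
    α≢β   : α ≢ β
open Gadget public

BwLE : {V : Set} → (V → V → Set) → ℕ → Set
BwLE {V} E k =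
  Σ[ N ∈ ℕ ] Σ[ σ ∈ V ⤖ Fin N ]
    (∀ u v → E u v → ∣ toℕ (Bijection.to σ u) - toℕ (Bijection.to σ v) ∣ ≤ k)

HasBandwidth : {V : Set} → (V → V → Set) → ℕ → Set
HasBandwidth E b = BwLE E b × (∀ k → BwLE E k → b ≤ k)

Adj : ∀ {n} → Graph n → Fin n → Fin n → Set
Adj G i j = T (adj G i j)

Edge : ∀ {n} → Graph n → Set
Edge {n} G = Σ[ i ∈ Fin n ] Σ[ j ∈ Fin n ] T ((toℕ i <ᵇ toℕ j) ∧ adj G i j)

Internal : ∀ {t} → Gadget t → Set
Internal {t} H = Σ[ x ∈ Fin t ] (False (x ≟ α H) × False (x ≟ β H))

-- Vertex set of G_H: original vertices plus a fresh copy of the internal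
-- vertices of H for every edge of G.
VH : ∀ {n t} → Graph n → Gadget t → Set
VH {n} G H = Fin n ⊎ (Edge G × Internal H)

-- An orientation decides, for each edge e = (i , j), whether α is identified
-- with i and β with j (true) or the other way round (false).
Orientation : ∀ {n} → Graph n → Set
Orientation G = Edge G → Bool

αEnd βEnd : ∀ {n} {G : Graph n} → Orientation G → Edge G → Fin n
αEnd o e with o e
... | true  = proj₁ e
... | false = proj₁ (proj₂ e)
βEnd o e with o e
... | true  = proj₁ (proj₂ e)
... | false = proj₁ e

emb : ∀ {n t} (G : Graph n) (H : Gadget t) → Orientation G →
      Edge G → Fin t → VH G H
emb G H o e x with x ≟ α H | x ≟ β H
... | yes _ | _     = inj₁ (αEnd {G = G} o e)
... | no _  | yes _ = inj₁ (βEnd {G = G} o e)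
... | no p  | no q  = inj₂ (e , x , fromWitnessFalse p , fromWitnessFalse q)

AdjH : ∀ {n t} (G : Graph n) (H : Gadget t) → Orientation G →
       VH G H → VH G H → Set
AdjH {t = t} G H o u v =
  Σ[ e ∈ Edge G ] Σ[ x ∈ Fin t ] Σ[ y ∈ Fin t ]
    (T (adj (graph H) x y) × emb G H o e x ≡ u × emb G H o e y ≡ v)

module Submission where

-- Fix a layout s of G of bandwidth b and put B = 1 + (t − 2) b.  Vertex v goes
-- to position s(v)·B, and the B − 1 positions after s(lo)·B host the internal
-- vertices of the edges whose lower endpoint in the layout is lo: an edge of
-- length d ∈ [1, b] uses the d-th block of t − 2 of them.  An edge is
-- determined by its lower endpoint and its length, so the placement is
-- injective, and every copy H_e lies in the window [s(lo)·B, s(hi)·B] of width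
-- at most b·B.  Ranking the positions turns this injective placement into a
-- layout of G_H without increasing any distance, so even bw(G_H) ≤ b·B.

open import Defs hiding (sym)
open import Data.Bool using (T; true; false)
open import Data.Bool.Properties using (T-∧; T-irrelevant)
open import Data.Empty using (⊥-elim)
open import Data.Fin using (Fin; zero; suc; toℕ; fromℕ<; punchOut)
open import Data.Fin.Properties
  using (0↔⊥; 1↔⊤; +↔⊎; *↔×; any?; punchOut-injective; injective⇒≤; toℕ<n; toℕ-fromℕ<; toℕ-injective)
  renaming (_≟_ to _≟ᶠ_; 0≢1+n to zero≢suc; suc-injective to Fin-suc-injective)
open import Data.Nat
open import Data.Nat.DivMod using ([m+kn]%n≡m%n; m<n⇒m%n≡m)
open import Data.Nat.Properties
open import Data.Product using (Σ; ∃-syntax; _×_; _,_; proj₁; proj₂)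
open import Data.Product.Function.NonDependent.Propositional using (_×-↔_)
open import Data.Sum using (_⊎_; inj₁; inj₂; [_,_])
open import Data.Sum.Function.Propositional using (_⊎-↔_)
open import Function using (_∘_; _↔_; _⤖_; Inverse; Equivalence; Bijection; mk⤖; mk↔ₛ′)
open import Function.Construct.Composition using (_⤖-∘_)
open import Function.Properties.Inverse using (↔-refl; ↔-sym; ↔-trans; ↔⇒⤖)
open import Level using (0ℓ)
open import Relation.Binary using (tri<; tri≈; tri>)
open import Relation.Binary.PropositionalEquality hiding ([_])
open import Relation.Nullary using (¬_; yes; no; _×-dec_)
open import Relation.Nullary.Decidable using (toWitnessFalse; fromWitnessFalse)
open import Relation.Unary using (Pred; Decidable; _⊆_; _∪_)

Finite : Set → Set
Finite V = ∃[ M ] (V ↔ Fin M)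

T-finite : ∀ x → Finite (T x)
T-finite true  = 1 , ↔-sym 1↔⊤
T-finite false = 0 , ↔-sym 0↔⊥

Fin-finite : ∀ k → Finite (Fin k)
Fin-finite k = k , ↔-refl

⊎-finite : ∀ {A B} → Finite A → Finite B → Finite (A ⊎ B)
⊎-finite (m , f) (n , g) = m + n , ↔-trans (f ⊎-↔ g) (↔-sym +↔⊎)

×-finite : ∀ {A B} → Finite A → Finite B → Finite (A × B)
×-finite (m , f) (n , g) = m * n , ↔-trans (f ×-↔ g) (↔-sym *↔×)

Σ-Fin-↔ : ∀ {k} (B : Fin (suc k) → Set) → Σ (Fin (suc k)) B ↔ (B zero ⊎ Σ (Fin k) (B ∘ suc))
Σ-Fin-↔ B = mk↔ₛ′ to from to∘from from∘to
  where
  to : Σ _ B → _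
  to (zero  , x) = inj₁ x
  to (suc i , x) = inj₂ (i , x)
  from : _ → Σ _ B
  from (inj₁ x)       = zero , x
  from (inj₂ (i , x)) = suc i , x
  to∘from : ∀ y → to (from y) ≡ y
  to∘from (inj₁ x)       = refl
  to∘from (inj₂ (i , x)) = refl
  from∘to : ∀ y → from (to y) ≡ y
  from∘to (zero  , x) = refl
  from∘to (suc i , x) = refl

Σ-Fin-finite : ∀ {k} {B : Fin k → Set} → (∀ i → Finite (B i)) → Finite (Σ (Fin k) B)
Σ-Fin-finite {zero}  _ = 0 , mk↔ₛ′ (λ ()) (λ ()) (λ ()) (λ ())
Σ-Fin-finite {suc k} {B} fin
  with M , e ← ⊎-finite (fin zero) (Σ-Fin-finite (fin ∘ suc))
  = M , ↔-trans (Σ-Fin-↔ B) e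

count : ∀ {M} {P : Pred (Fin M) 0ℓ} → Decidable P → ℕ
count {zero}  P? = 0
count {suc M} P? with P? zero
... | yes _ = suc (count (P? ∘ suc))
... | no  _ = count (P? ∘ suc)

count-tail : ∀ {M} {P : Pred (Fin (suc M)) 0ℓ} (P? : Decidable P) → count (P? ∘ suc) ≤ count P?
count-tail P? with P? zero
... | yes _ = n≤1+n _
... | no  _ = ≤-refl

count≡0 : ∀ {M} {P : Pred (Fin M) 0ℓ} (P? : Decidable P) → (∀ {w} → ¬ P w) → count P? ≡ 0
count≡0 {zero}  P? ¬P = refl
count≡0 {suc M} P? ¬P with P? zero
... | yes p = ⊥-elim (¬P p)
... | no  _ = count≡0 (P? ∘ suc) ¬P

count≤M : ∀ {M} {P : Pred (Fin M) 0ℓ} (P? : Decidable P) → count P? ≤ M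
count≤M {zero}  P? = z≤n
count≤M {suc M} P? with P? zero
... | yes _ = s≤s (count≤M (P? ∘ suc))
... | no  _ = m≤n⇒m≤1+n (count≤M (P? ∘ suc))

count<M : ∀ {M} {P : Pred (Fin M) 0ℓ} (P? : Decidable P) (w : Fin M) → ¬ P w → count P? < M
count<M {suc M} P? w ¬Pw with P? zero
count<M {suc M} P? zero    ¬Pw | yes P0 = ⊥-elim (¬Pw P0)
count<M {suc M} P? (suc w) ¬Pw | yes _  = s≤s (count<M (P? ∘ suc) w ¬Pw)
count<M {suc M} P? zero    ¬Pw | no  _  = s≤s (count≤M (P? ∘ suc))
count<M {suc M} P? (suc w) ¬Pw | no  _  = m<n⇒m<1+n (count<M (P? ∘ suc) w ¬Pw)

count-mono : ∀ {M} {P Q : Pred (Fin M) 0ℓ} (P? : Decidable P) (Q? : Decidable Q) →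
             P ⊆ Q → count P? ≤ count Q?
count-mono {zero}  P? Q? P⊆Q = z≤n
count-mono {suc M} P? Q? P⊆Q with P? zero | Q? zero
... | yes _  | yes _  = s≤s (count-mono (P? ∘ suc) (Q? ∘ suc) P⊆Q)
... | no  _  | yes _  = m≤n⇒m≤1+n (count-mono (P? ∘ suc) (Q? ∘ suc) P⊆Q)
... | no  _  | no  _  = count-mono (P? ∘ suc) (Q? ∘ suc) P⊆Q
... | yes P0 | no ¬Q0 = ⊥-elim (¬Q0 (P⊆Q P0))

count-mono-< : ∀ {M} {P Q : Pred (Fin M) 0ℓ} (P? : Decidable P) (Q? : Decidable Q) →
               P ⊆ Q → (w : Fin M) → Q w → ¬ P w → count P? < count Q?
count-mono-< {suc M} P? Q? P⊆Q w Qw ¬Pw with P? zero | Q? zero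
count-mono-< {suc M} P? Q? P⊆Q w       Qw ¬Pw | yes P0 | no ¬Q0 = ⊥-elim (¬Q0 (P⊆Q P0))
count-mono-< {suc M} P? Q? P⊆Q zero    Qw ¬Pw | yes P0 | yes _  = ⊥-elim (¬Pw P0)
count-mono-< {suc M} P? Q? P⊆Q zero    Qw ¬Pw | no _   | no ¬Q0 = ⊥-elim (¬Q0 Qw)
count-mono-< {suc M} P? Q? P⊆Q zero    Qw ¬Pw | no _   | yes _  =
  s≤s (count-mono (P? ∘ suc) (Q? ∘ suc) P⊆Q)
count-mono-< {suc M} P? Q? P⊆Q (suc w) Qw ¬Pw | yes _  | yes _  =
  s≤s (count-mono-< (P? ∘ suc) (Q? ∘ suc) P⊆Q w Qw ¬Pw)
count-mono-< {suc M} P? Q? P⊆Q (suc w) Qw ¬Pw | no _   | yes _  =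
  m<n⇒m<1+n (count-mono-< (P? ∘ suc) (Q? ∘ suc) P⊆Q w Qw ¬Pw)
count-mono-< {suc M} P? Q? P⊆Q (suc w) Qw ¬Pw | no _   | no _   =
  count-mono-< (P? ∘ suc) (Q? ∘ suc) P⊆Q w Qw ¬Pw

count-subadditive : ∀ {M} {P Q R : Pred (Fin M) 0ℓ} (P? : Decidable P) (Q? : Decidable Q) (R? : Decidable R) →
                    P ⊆ Q ∪ R → count P? ≤ count Q? + count R?
count-subadditive {zero}  P? Q? R? P⊆Q∪R = z≤n
count-subadditive {suc M} P? Q? R? P⊆Q∪R
  with IH ← count-subadditive (P? ∘ suc) (Q? ∘ suc) (R? ∘ suc) P⊆Q∪R | P? zero
... | no _ = ≤-trans IH (+-mono-≤ (count-tail Q?) (count-tail R?))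
... | yes P0 with Q? zero
...   | yes _ = s≤s (≤-trans IH (+-monoʳ-≤ _ (count-tail R?)))
...   | no ¬Q0 with R? zero
...     | yes _  = ≤-trans (s≤s IH) (≤-reflexive (sym (+-suc _ _)))
...     | no ¬R0 = ⊥-elim ([ ¬Q0 , ¬R0 ] (P⊆Q∪R P0))

count≤1 : ∀ {M} {P : Pred (Fin M) 0ℓ} (P? : Decidable P) → (∀ {v w} → P v → P w → v ≡ w) → count P? ≤ 1
count≤1 {zero}  P? unique = z≤n
count≤1 {suc M} P? unique with P? zero
... | yes P0 = s≤s (≤-reflexive (count≡0 (P? ∘ suc) (zero≢suc ∘ unique P0)))
... | no  _  = count≤1 (P? ∘ suc) (λ Pv Pw → Fin-suc-injective (unique Pv Pw))

count-window : ∀ {M} {P : Pred (Fin M) 0ℓ} (P? : Decidable P) (q : Fin M → ℕ) →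
               (∀ {v w} → q v ≡ q w → v ≡ w) → ∀ a L →
               (∀ {w} → P w → a ≤ q w × q w < a + L) → count P? ≤ L
count-window P? q q-injective a zero in-window = ≤-reflexive (count≡0 P? λ Pw →
  ≤⇒≯ (proj₁ (in-window Pw)) (subst (_ <_) (+-identityʳ a) (proj₂ (in-window Pw))))
count-window {P = P} P? q q-injective a (suc L) in-window = begin
  count P?                     ≤⟨ count-subadditive P? below? top? cover ⟩
  count below? + count top?    ≤⟨ +-mono-≤ below≤L top≤1 ⟩
  L + 1                        ≡⟨ +-comm L 1 ⟩
  suc L                        ∎
  where
  open ≤-Reasoning
  below? = λ w → P? w ×-dec (q w <? a + L)
  top?   = λ w → q w ≟ a + L
  below≤L = count-window below? q q-injective a L (λ (Pw , lt) → proj₁ (in-window Pw) , lt)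
  top≤1   = count≤1 top? (λ v-top w-top → q-injective (trans v-top (sym w-top)))
  cover : P ⊆ (λ w → P w × q w < a + L) ∪ (λ w → q w ≡ a + L)
  cover {w} Pw with m<1+n⇒m<n∨m≡n (subst (q w <_) (+-suc a L) (proj₂ (in-window Pw)))
  ... | inj₁ lt = inj₁ (Pw , lt)
  ... | inj₂ eq = inj₂ eq

injective⇒surjective : ∀ {n} (f : Fin n → Fin n) → (∀ {x y} → f x ≡ f y → x ≡ y) → ∀ y → ∃[ x ] f x ≡ y
injective⇒surjective {n} f f-injective y with any? (λ x → f x ≟ᶠ y)
... | yes hit = hit
injective⇒surjective {suc n} f f-injective y | no miss = ⊥-elim (<-irrefl refl (injective⇒≤ g-injective))
  where
  -- f misses y, so f followed by deleting y injects Fin (suc n) into Fin n.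
  g : Fin (suc n) → Fin n
  g x = punchOut {i = y} {j = f x} (λ y≡fx → miss (x , sym y≡fx))
  g-injective : ∀ {x x′} → g x ≡ g x′ → x ≡ x′
  g-injective {x} {x′} =
    f-injective ∘ punchOut-injective (λ y≡fx → miss (x , sym y≡fx)) (λ y≡fx′ → miss (x′ , sym y≡fx′))

module Rank {M : ℕ} (q : Fin M → ℕ) (q-injective : ∀ {k l} → q k ≡ q l → k ≡ l) where

  below? : ∀ k → Decidable (λ w → q w < q k)
  below? k w = q w <? q k

  rank : Fin M → ℕ
  rank k = count (below? k)

  rank<M : ∀ k → rank k < M
  rank<M k = count<M (below? k) k (<-irrefl refl)

  rank-mono-≤ : ∀ {k l} → q k ≤ q l → rank k ≤ rank l
  rank-mono-≤ {k} {l} qk≤ql = count-mono (below? k) (below? l) (λ lt → <-≤-trans lt qk≤ql)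

  rank-mono-< : ∀ {k l} → q k < q l → rank k < rank l
  rank-mono-< {k} {l} qk<ql = count-mono-< (below? k) (below? l) (λ lt → <-trans lt qk<ql) k qk<ql (<-irrefl refl)

  -- Every point ranked below l but not below k has its q-value in [q k, q l).
  rank-gap : ∀ {k l} → q k ≤ q l → rank l ≤ rank k + (q l ∸ q k)
  rank-gap {k} {l} qk≤ql =
    ≤-trans (count-subadditive (below? l) (below? k) between? cover)
            (+-monoʳ-≤ (rank k) (count-window between? q q-injective (q k) (q l ∸ q k) in-window))
    where
    between? = λ w → (q k ≤? q w) ×-dec (q w <? q l)
    cover : ∀ {w} → q w < q l → q w < q k ⊎ (q k ≤ q w × q w < q l)
    cover {w} lt with q w <? q k
    ... | yes below = inj₁ below
    ... | no ¬below = inj₂ (≮⇒≥ ¬below , lt)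
    in-window : ∀ {w} → q k ≤ q w × q w < q l → q k ≤ q w × q w < q k + (q l ∸ q k)
    in-window {w} (ge , lt) = ge , subst (q w <_) (sym (m+[n∸m]≡n qk≤ql)) lt

  rank-stretch-≤ : ∀ {k l} → q k ≤ q l → ∣ rank k - rank l ∣ ≤ ∣ q k - q l ∣
  rank-stretch-≤ {k} {l} qk≤ql = begin
    ∣ rank k - rank l ∣  ≡⟨ m≤n⇒∣m-n∣≡n∸m (rank-mono-≤ qk≤ql) ⟩
    rank l ∸ rank k      ≤⟨ m≤n+o⇒m∸n≤o (rank l) (rank k) (rank-gap qk≤ql) ⟩
    q l ∸ q k            ≡⟨ m≤n⇒∣m-n∣≡n∸m qk≤ql ⟨
    ∣ q k - q l ∣        ∎
    where open ≤-Reasoning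

  rank-stretch : ∀ k l → ∣ rank k - rank l ∣ ≤ ∣ q k - q l ∣
  rank-stretch k l with ≤-total (q k) (q l)
  ... | inj₁ qk≤ql = rank-stretch-≤ qk≤ql
  ... | inj₂ ql≤qk = subst₂ _≤_ (∣-∣-comm (rank l) (rank k)) (∣-∣-comm (q l) (q k)) (rank-stretch-≤ ql≤qk)

  rank-injective : ∀ {k l} → rank k ≡ rank l → k ≡ l
  rank-injective {k} {l} eq with <-cmp (q k) (q l)
  ... | tri< qk<ql _ _ = ⊥-elim (<⇒≢ (rank-mono-< qk<ql) eq)
  ... | tri≈ _ qk≡ql _ = q-injective qk≡ql
  ... | tri> _ _ qk>ql = ⊥-elim (<⇒≢ (rank-mono-< qk>ql) (sym eq))

  rankᶠ : Fin M → Fin M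
  rankᶠ k = fromℕ< (rank<M k)

  rankᶠ-injective : ∀ {k l} → rankᶠ k ≡ rankᶠ l → k ≡ l
  rankᶠ-injective {k} {l} eq =
    rank-injective (trans (sym (toℕ-fromℕ< (rank<M k))) (trans (cong toℕ eq) (toℕ-fromℕ< (rank<M l))))

  rank-bijection : Fin M ⤖ Fin M
  rank-bijection = mk⤖ (rankᶠ-injective , λ y → let (x , eq) = injective⇒surjective rankᶠ rankᶠ-injective y
                                                 in x , λ { refl → eq })

  rankᶠ-stretch : ∀ k l → ∣ toℕ (rankᶠ k) - toℕ (rankᶠ l) ∣ ≤ ∣ q k - q l ∣
  rankᶠ-stretch k l rewrite toℕ-fromℕ< (rank<M k) | toℕ-fromℕ< (rank<M l) = rank-stretch k l

injective-placement⇒BwLE : ∀ {V : Set} {E : V → V → Set} {k} → Finite V →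
  (p : V → ℕ) → (∀ {u v} → p u ≡ p v → u ≡ v) → (∀ u v → E u v → ∣ p u - p v ∣ ≤ k) → BwLE E k
injective-placement⇒BwLE (M , V↔M) p p-injective p-stretch =
  M , rank-bijection ⤖-∘ ↔⇒⤖ V↔M , λ u v uv → ≤-trans (stretch u v) (p-stretch u v uv)
  where
  open Inverse V↔M
  q : Fin M → ℕ
  q = p ∘ from
  open Rank q (Bijection.injective (↔⇒⤖ (↔-sym V↔M)) ∘ p-injective)
  stretch : ∀ u v → ∣ toℕ (rankᶠ (to u)) - toℕ (rankᶠ (to v)) ∣ ≤ ∣ p u - p v ∣
  stretch u v = subst₂ (λ u′ v′ → ∣ toℕ (rankᶠ (to u)) - toℕ (rankᶠ (to v)) ∣ ≤ ∣ p u′ - p v′ ∣)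
                       (strictlyInverseʳ u) (strictlyInverseʳ v) (rankᶠ-stretch (to u) (to v))

*+-injective : ∀ B {a a′ r r′} → r < B → r′ < B → a * B + r ≡ a′ * B + r′ → a ≡ a′ × r ≡ r′
*+-injective B {a} {a′} {r} {r′} r<B r′<B eq = a≡a′ , r≡r′
  where
  instance
    B-nonZero : NonZero B
    B-nonZero = >-nonZero (≤-<-trans z≤n r<B)
  remainder : ∀ a r → r < B → (a * B + r) % B ≡ r
  remainder a r r<B = trans (cong (_% B) (+-comm (a * B) r)) (trans ([m+kn]%n≡m%n r a B) (m<n⇒m%n≡m r<B))
  r≡r′ = trans (sym (remainder a r r<B)) (trans (cong (_% B) eq) (remainder a′ r′ r′<B))
  a≡a′ = *-cancelʳ-≡ a a′ B (+-cancelʳ-≡ r (a * B) (a′ * B) (trans eq (cong (a′ * B +_) (sym r≡r′))))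

m≤m⊓n+∣m-n∣ : ∀ m n → m ≤ m ⊓ n + ∣ m - n ∣
m≤m⊓n+∣m-n∣ m n with ≤-total m n
... | inj₁ m≤n rewrite m≤n⇒m⊓n≡m m≤n = m≤m+n m _
... | inj₂ n≤m rewrite m≥n⇒m⊓n≡n n≤m | ∣-∣-comm m n | m≤n⇒∣m-n∣≡n∸m n≤m = ≤-reflexive (sym (m+[n∸m]≡n n≤m))

n≤m⊓n+∣m-n∣ : ∀ m n → n ≤ m ⊓ n + ∣ m - n ∣
n≤m⊓n+∣m-n∣ m n rewrite ⊓-comm m n | ∣-∣-comm m n = m≤m⊓n+∣m-n∣ n m

⊓-∣-∣-injective : ∀ {m n m′ n′} → m ⊓ n ≡ m′ ⊓ n′ → ∣ m - n ∣ ≡ ∣ m′ - n′ ∣ →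
                  (m ≡ m′ × n ≡ n′) ⊎ (m ≡ n′ × n ≡ m′)
⊓-∣-∣-injective {m} {n} {m′} {n′} ⊓≡ ∣-∣≡ with sorted m n | sorted m′ n′
  where
  sorted : ∀ m n → (m ⊓ n ≡ m × n ≡ m + ∣ m - n ∣) ⊎ (m ⊓ n ≡ n × m ≡ n + ∣ m - n ∣)
  sorted m n with ≤-total m n
  ... | inj₁ m≤n = inj₁ (m≤n⇒m⊓n≡m m≤n , sym (trans (cong (m +_) (m≤n⇒∣m-n∣≡n∸m m≤n)) (m+[n∸m]≡n m≤n)))
  ... | inj₂ n≤m = inj₂ (m≥n⇒m⊓n≡n n≤m ,
                         sym (trans (cong (n +_) (trans (∣-∣-comm m n) (m≤n⇒∣m-n∣≡n∸m n≤m))) (m+[n∸m]≡n n≤m)))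
... | inj₁ (⊓≡m , n≡) | inj₁ (⊓≡m′ , n′≡) = inj₁ (m≡ , trans n≡ (trans (cong₂ _+_ m≡ ∣-∣≡) (sym n′≡)))
  where m≡ = trans (sym ⊓≡m) (trans ⊓≡ ⊓≡m′)
... | inj₁ (⊓≡m , n≡) | inj₂ (⊓≡n′ , m′≡) = inj₂ (m≡ , trans n≡ (trans (cong₂ _+_ m≡ ∣-∣≡) (sym m′≡)))
  where m≡ = trans (sym ⊓≡m) (trans ⊓≡ ⊓≡n′)
... | inj₂ (⊓≡n , m≡) | inj₁ (⊓≡m′ , n′≡) = inj₂ (trans m≡ (trans (cong₂ _+_ n≡ ∣-∣≡) (sym n′≡)) , n≡)
  where n≡ = trans (sym ⊓≡n) (trans ⊓≡ ⊓≡m′)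
... | inj₂ (⊓≡n , m≡) | inj₂ (⊓≡n′ , m′≡) = inj₁ (trans m≡ (trans (cong₂ _+_ n≡ ∣-∣≡) (sym m′≡)) , n≡)
  where n≡ = trans (sym ⊓≡n) (trans ⊓≡ ⊓≡n′)

∣-∣≤width : ∀ {a c x y} → a ≤ x → x ≤ c → a ≤ y → y ≤ c → ∣ x - y ∣ ≤ c ∸ a
∣-∣≤width {x = x} {y} a≤x x≤c a≤y y≤c with ≤-total x y
... | inj₁ x≤y = subst (_≤ _) (sym (m≤n⇒∣m-n∣≡n∸m x≤y)) (∸-mono y≤c a≤x)
... | inj₂ y≤x = subst (_≤ _) (sym (trans (∣-∣-comm x y) (m≤n⇒∣m-n∣≡n∸m y≤x))) (∸-mono x≤c a≤y)

punchOut₂ : ∀ {t} {a b x : Fin t} → a ≢ b → a ≢ x → b ≢ x → Fin (t ∸ 2)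
punchOut₂ {suc zero}    {zero} {zero} a≢b _ _ = ⊥-elim (a≢b refl)
punchOut₂ {suc (suc t)} a≢b a≢x b≢x =
  punchOut {i = punchOut a≢b} {j = punchOut a≢x} (b≢x ∘ punchOut-injective a≢b a≢x)

punchOut₂-injective : ∀ {t} {a b x y : Fin t} (a≢b : a ≢ b)
  (a≢x : a ≢ x) (b≢x : b ≢ x) (a≢y : a ≢ y) (b≢y : b ≢ y) →
  punchOut₂ a≢b a≢x b≢x ≡ punchOut₂ a≢b a≢y b≢y → x ≡ y
punchOut₂-injective {suc zero}    {zero} {zero} a≢b _ _ _ _ _ = ⊥-elim (a≢b refl)
punchOut₂-injective {suc (suc t)} a≢b a≢x b≢x a≢y b≢y =
  punchOut-injective a≢x a≢y ∘
  punchOut-injective (b≢x ∘ punchOut-injective a≢b a≢x) (b≢y ∘ punchOut-injective a≢b a≢y)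

internalIndex : ∀ {t} (H : Gadget t) → Internal H → Fin (t ∸ 2)
internalIndex H (x , x≢α , x≢β) = punchOut₂ (α≢β H) (≢-sym (toWitnessFalse x≢α)) (≢-sym (toWitnessFalse x≢β))

internalIndex-injective : ∀ {t} (H : Gadget t) {u v : Internal H} → internalIndex H u ≡ internalIndex H v → u ≡ v
internalIndex-injective H {x , x≢α , x≢β} {y , y≢α , y≢β} eq
  with refl ← punchOut₂-injective (α≢β H) _ _ _ _ eq
  = cong₂ (λ p q → x , p , q) (T-irrelevant x≢α y≢α) (T-irrelevant x≢β y≢β)

VH-finite : ∀ {n t} (G : Graph n) (H : Gadget t) → Finite (VH G H)
VH-finite {n} G H =
  ⊎-finite (Fin-finite n)
           (×-finite (Σ-Fin-finite λ i → Σ-Fin-finite λ j → T-finite _)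
                     (Σ-Fin-finite λ x → ×-finite (T-finite _) (T-finite _)))

module Placement {n t b N : ℕ} (G : Graph n) (H : Gadget t) (o : Orientation G) (σ : Fin n ⤖ Fin N)
                 (σ-stretch : ∀ u v → Adj G u v → ∣ toℕ (Bijection.to σ u) - toℕ (Bijection.to σ v) ∣ ≤ b) where

  s : Fin n → ℕ
  s = toℕ ∘ Bijection.to σ

  s-injective : ∀ {i j} → s i ≡ s j → i ≡ j
  s-injective = Bijection.injective σ ∘ toℕ-injective

  inner B : ℕ
  inner = t ∸ 2
  B = 1 + inner * b

  first second : Edge G → Fin n
  first  = proj₁
  second = proj₁ ∘ proj₂

  first<second : ∀ e → toℕ (first e) < toℕ (second e)
  first<second (i , j , i<j∧ij) = <ᵇ⇒< (toℕ i) (toℕ j) (proj₁ (Equivalence.to T-∧ i<j∧ij))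

  lo len hi : Edge G → ℕ
  lo  e = s (first e) ⊓ s (second e)
  len e = ∣ s (first e) - s (second e) ∣
  hi  e = lo e + len e

  len≤b : ∀ e → len e ≤ b
  len≤b (i , j , i<j∧ij) = σ-stretch i j (proj₂ (Equivalence.to T-∧ i<j∧ij))

  len-nonZero : ∀ e → NonZero (len e)
  len-nonZero e = ≢-nonZero λ len≡0 →
    <⇒≢ (first<second e) (cong toℕ (s-injective {first e} {second e} (∣m-n∣≡0⇒m≡n len≡0)))

  edge-≡ : ∀ {e e′} → first e ≡ first e′ → second e ≡ second e′ → e ≡ e′
  edge-≡ {i , j , p} {.i , .j , p′} refl refl = cong (λ p → i , j , p) (T-irrelevant p p′)

  lo-len-injective : ∀ {e e′} → lo e ≡ lo e′ → len e ≡ len e′ → e ≡ e′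
  lo-len-injective {e} {e′} lo≡ len≡ with ⊓-∣-∣-injective lo≡ len≡
  ... | inj₁ (≡first , ≡second) = edge-≡ (s-injective ≡first) (s-injective ≡second)
  ... | inj₂ (≡second′ , ≡first′) = ⊥-elim (<-asym (first<second e) (subst₂ (λ i j → toℕ i < toℕ j)
          (sym (s-injective ≡first′)) (sym (s-injective ≡second′)) (first<second e′)))

  slot : Edge G → Internal H → ℕ
  slot e y = pred (len e) * inner + toℕ (internalIndex H y)

  slot<inner*b : ∀ e y → slot e y < inner * b
  slot<inner*b e y = begin-strict
    pred (len e) * inner + toℕ (internalIndex H y) <⟨ +-monoʳ-< _ (toℕ<n (internalIndex H y)) ⟩
    pred (len e) * inner + inner                    ≡⟨ +-comm _ inner ⟩
    suc (pred (len e)) * inner                      ≡⟨ cong (_* inner) (suc-pred (len e) {{len-nonZero e}}) ⟩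
    len e * inner                                   ≤⟨ *-monoˡ-≤ inner (len≤b e) ⟩
    b * inner                                       ≡⟨ *-comm b inner ⟩
    inner * b                                       ∎
    where open ≤-Reasoning

  suc-slot<B : ∀ e y → suc (slot e y) < B
  suc-slot<B e y = s≤s (slot<inner*b e y)

  place : VH G H → ℕ
  place (inj₁ i)       = s i * B
  place (inj₂ (e , y)) = lo e * B + suc (slot e y)

  place-injective : ∀ {u v} → place u ≡ place v → u ≡ v
  place-injective {inj₁ i} {inj₁ j} eq = cong inj₁ (s-injective (*-cancelʳ-≡ (s i) (s j) B eq))
  place-injective {inj₁ i} {inj₂ (e , y)} eq
    with () ← proj₂ (*+-injective B {s i} {lo e} z<s (suc-slot<B e y) (trans (+-identityʳ _) eq))
  place-injective {inj₂ (e , y)} {inj₁ i} eq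
    with () ← proj₂ (*+-injective B {lo e} {s i} (suc-slot<B e y) z<s (trans eq (sym (+-identityʳ _))))
  place-injective {inj₂ (e , y)} {inj₂ (e′ , y′)} eq
    with lo≡ , slot≡ ← *+-injective B (suc-slot<B e y) (suc-slot<B e′ y′) eq
    with pred-len≡ , index≡ ← *+-injective inner (toℕ<n _) (toℕ<n _) (suc-injective slot≡)
    with refl ← lo-len-injective {e} {e′} lo≡ (pred-injective {{len-nonZero e}} {{len-nonZero e′}} pred-len≡)
    with refl ← internalIndex-injective H {y} {y′} (toℕ-injective index≡)
    = refl

  InWindow : Edge G → ℕ → Set
  InWindow e m = lo e * B ≤ m × m ≤ hi e * B

  first-in-window : ∀ e → InWindow e (place (inj₁ (first e)))
  first-in-window e =
    *-monoˡ-≤ B (m⊓n≤m (s (first e)) (s (second e))) , *-monoˡ-≤ B (m≤m⊓n+∣m-n∣ (s (first e)) (s (second e)))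

  second-in-window : ∀ e → InWindow e (place (inj₁ (second e)))
  second-in-window e =
    *-monoˡ-≤ B (m⊓n≤n (s (first e)) (s (second e))) , *-monoˡ-≤ B (n≤m⊓n+∣m-n∣ (s (first e)) (s (second e)))

  internal-in-window : ∀ e y → InWindow e (place (inj₂ (e , y)))
  internal-in-window e y = m≤m+n _ _ , (begin
    lo e * B + suc (slot e y)  ≤⟨ +-monoʳ-≤ (lo e * B) (<⇒≤ (suc-slot<B e y)) ⟩
    lo e * B + B               ≤⟨ +-monoʳ-≤ (lo e * B) (m≤n*m B (len e) {{len-nonZero e}}) ⟩
    lo e * B + len e * B       ≡⟨ *-distribʳ-+ B (lo e) (len e) ⟨
    hi e * B                   ∎)
    where open ≤-Reasoning

  αEnd-in-window : ∀ e → InWindow e (place (inj₁ (αEnd {G = G} o e)))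
  αEnd-in-window e with o e
  ... | true  = first-in-window e
  ... | false = second-in-window e

  βEnd-in-window : ∀ e → InWindow e (place (inj₁ (βEnd {G = G} o e)))
  βEnd-in-window e with o e
  ... | true  = second-in-window e
  ... | false = first-in-window e

  emb-in-window : ∀ e x → InWindow e (place (emb G H o e x))
  emb-in-window e x with x ≟ᶠ α H | x ≟ᶠ β H
  ... | yes _  | _      = αEnd-in-window e
  ... | no _   | yes _  = βEnd-in-window e
  ... | no x≢α | no x≢β = internal-in-window e (x , fromWitnessFalse x≢α , fromWitnessFalse x≢β)

  place-stretch : ∀ u v → AdjH G H o u v → ∣ place u - place v ∣ ≤ b * B
  place-stretch _ _ (e , x , y , _ , refl , refl) = begin
    ∣ place (emb G H o e x) - place (emb G H o e y) ∣
      ≤⟨ ∣-∣≤width (proj₁ (emb-in-window e x)) (proj₂ (emb-in-window e x))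
                   (proj₁ (emb-in-window e y)) (proj₂ (emb-in-window e y)) ⟩
    hi e * B ∸ lo e * B  ≡⟨ *-distribʳ-∸ B (hi e) (lo e) ⟨
    (hi e ∸ lo e) * B    ≡⟨ cong (_* B) (m+n∸m≡n (lo e) (len e)) ⟩
    len e * B            ≤⟨ *-monoˡ-≤ B (len≤b e) ⟩
    b * B                ∎
    where open ≤-Reasoning

lemma21 : (n t b : ℕ) (G : Graph n) (H : Gadget t) (o : Orientation G) →
          HasBandwidth (Adj G) b →
          BwLE (AdjH G H o) ((b + 1) * (1 + (t ∸ 2) * b))
lemma21 _ _ b G H o ((_ , σ , σ-stretch) , _) =
  injective-placement⇒BwLE (VH-finite G H) place place-injective
    (λ u v uv → ≤-trans (place-stretch u v uv) (*-monoˡ-≤ B (m≤m+n b 1)))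
  where open Placement G H o σ σ-stretch
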